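{- Let $\mathbf{S}$ be a hereditary closed set of positions of a ruleset. Then every position $G\in\mathbf{S}$ is (equal in value to) a number if and only if there is no position $G\in\mathbf{S}$ and no number $x$ such that the disjunctive sum $G+x$ is an $\mathcal{N}$-position.
   Context: We work in normal-play combinatorial game theory with short partizan games (finitely many positions, no infinite play), with the usual disjunctive sum $+$, negation, and partial order $\leqslant$ on game values. For a position $G$, $G^{\mathcal{L}}$ and $G^{\mathcal{R}}$ denote the sets of Left and Right options, $G^L$, $G^R$ denote typical elements. A position is in $\mathcal{N}$ if the first player to move wins. A "number" is a game equal to a surreal number (dyadic rational) in the standard sense. A set $\mathbf{S}$ of positions of a ruleset is a hereditary closed set of positions of a ruleset (HCR) if it is closed under taking options, i.e. every option of every position in $\mathbf{S}$ is again in $\mathbf{S}$. -}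

module Defs where

open import Data.List using (List; []; _∷_; _++_)
open import Data.List.Relation.Unary.All using (All)
open import Data.Product using (_×_; Σ; _,_)
open import Data.Sum using (_⊎_)
open import Data.Unit using (⊤)
open import Data.Empty using (⊥)
open import Relation.Nullary using (¬_)

-- Short partizan game forms: a game is given by finite lists of Left and
-- Right options.  Well-foundedness (no infinite play) is automatic.
data Game : Set where
  ⟨_∣_⟩ : List Game → List Game → Game

leftOpts : Game → List Game
leftOpts ⟨ L ∣ R ⟩ = L

rightOpts : Game → List Game
rightOpts ⟨ L ∣ R ⟩ = R

mutual
  _≤g_ : Game → Game → Set
  ⟨ GL ∣ GR ⟩ ≤g ⟨ HL ∣ HR ⟩ = NoneAbove ⟨ HL ∣ HR ⟩ GL × NoneBelow ⟨ GL ∣ GR ⟩ HR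

  NoneAbove : Game → List Game → Set
  NoneAbove H [] = ⊤
  NoneAbove H (x ∷ xs) = ¬ (H ≤g x) × NoneAbove H xs

  NoneBelow : Game → List Game → Set
  NoneBelow G [] = ⊤
  NoneBelow G (y ∷ ys) = ¬ (y ≤g G) × NoneBelow G ys

_≈g_ : Game → Game → Set
G ≈g H = G ≤g H × H ≤g G

_<g_ : Game → Game → Set
G <g H = G ≤g H × ¬ (H ≤g G)

mutual
  _+g_ : Game → Game → Game
  ⟨ GL ∣ GR ⟩ +g ⟨ HL ∣ HR ⟩ =
    ⟨ addR GL ⟨ HL ∣ HR ⟩ ++ addL ⟨ GL ∣ GR ⟩ HL
    ∣ addR GR ⟨ HL ∣ HR ⟩ ++ addL ⟨ GL ∣ GR ⟩ HR ⟩

  addR : List Game → Game → List Game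
  addR [] H = []
  addR (x ∷ xs) H = (x +g H) ∷ addR xs H

  addL : Game → List Game → List Game
  addL G [] = []
  addL G (y ∷ ys) = (G +g y) ∷ addL G ys

-- Outcomes under normal play.
-- LeftWinsFirst G : Left, moving first in G, has a winning strategy,
-- i.e. some Left option G^L from which Right (moving first) does not win.
mutual
  LeftWinsFirst : Game → Set
  LeftWinsFirst ⟨ L ∣ R ⟩ = SomeRightLoses L

  RightWinsFirst : Game → Set
  RightWinsFirst ⟨ L ∣ R ⟩ = SomeLeftLoses R

  SomeRightLoses : List Game → Set
  SomeRightLoses [] = ⊥
  SomeRightLoses (x ∷ xs) = ¬ (RightWinsFirst x) ⊎ SomeRightLoses xs

  SomeLeftLoses : List Game → Set
  SomeLeftLoses [] = ⊥
  SomeLeftLoses (x ∷ xs) = ¬ (LeftWinsFirst x) ⊎ SomeLeftLoses xs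

InN : Game → Set
InN G = LeftWinsFirst G × RightWinsFirst G

mutual
  IsNumericForm : Game → Set
  IsNumericForm ⟨ L ∣ R ⟩ =
    AllNumeric L × AllNumeric R × All (λ l → All (λ r → l <g r) R) L

  AllNumeric : List Game → Set
  AllNumeric [] = ⊤
  AllNumeric (x ∷ xs) = IsNumericForm x × AllNumeric xs

IsNumber : Game → Set
IsNumber G = Σ Game (λ x → IsNumericForm x × (G ≈g x))

IsHCR : (Game → Set) → Set
IsHCR S = (G : Game) → S G → All S (leftOpts G) × All S (rightOpts G)

{-# OPTIONS --safe #-}
module Submission where

-- If every position of S is a number, then G + x is a sum of numbers, hence
-- comparable with 0, and so never an N-position.  Conversely, argue by
-- induction on positions of S.  Once the options of G are numbers, replace
-- them by equal numeric forms.  Either the result is a numeric form (and equals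
-- G), or some Right option r and Left option l straddle a numeric form z,
-- r ≤ z ≤ l.  In the latter case G − z is an N-position: Left wins by moving to
-- l − z ≥ 0 and Right wins by moving to r − z ≤ 0.

open import Defs
open import Data.Product using (_×_; Σ; _,_; proj₁; proj₂)
open import Data.Sum using (_⊎_; inj₁; inj₂; fromInj₁)
open import Data.Unit using (tt)
open import Data.Empty using (⊥-elim)
open import Data.List using (List; []; _∷_)
open import Data.List.Membership.Propositional using (_∈_; find)
open import Data.List.Membership.Propositional.Properties using (∈-++⁺ˡ; ∈-++⁺ʳ)
open import Data.List.Relation.Binary.Subset.Propositional using (_⊆_)
open import Data.List.Relation.Binary.Pointwise using (Pointwise; []; _∷_)
open import Data.List.Relation.Unary.Any using (here; there)
open import Data.List.Relation.Unary.All as All using (All; []; _∷_; all?)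
open import Data.List.Relation.Unary.All.Properties using (++⁺; ¬All⇒Any¬)
open import Function using (id; _∘_; flip)
open import Relation.Nullary using (¬_; Dec; yes; no; ¬?)
open import Relation.Nullary.Decidable using (_×-dec_; decidable-stable)
open import Relation.Unary using (Decidable)
open import Relation.Binary.PropositionalEquality using (_≡_; refl; cong₂; subst)

0g : Game
0g = ⟨ [] ∣ [] ⟩

Comparable : Game → Game → Set
Comparable G H = G ≤g H ⊎ H ≤g G

¬All⇒∃¬ : ∀ {A : Set} {P : A → Set} → Decidable P → ∀ {xs} →
          ¬ All P xs → Σ A λ x → x ∈ xs × ¬ P x
¬All⇒∃¬ P? ¬all = find (¬All⇒Any¬ P? _ ¬all)

Covered : ∀ {A B : Set} → (A → B → Set) → List A → List B → Set
Covered {B = B} R xs ys = ∀ {x} → x ∈ xs → Σ B λ y → y ∈ ys × R x y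

module _ {A B : Set} {R : A → B → Set} where

  Covered-map : ∀ {S : A → B → Set} {xs ys} → (∀ {x y} → R x y → S x y) →
                Covered R xs ys → Covered S xs ys
  Covered-map f cov x∈ = let y , y∈ , r = cov x∈ in y , y∈ , f r

  pointwise⇒covered : ∀ {xs ys} → Pointwise R xs ys → Covered R xs ys
  pointwise⇒covered (r ∷ _) (here refl) = _ , here refl , r
  pointwise⇒covered (_ ∷ rs) (there x∈) =
    let y , y∈ , r = pointwise⇒covered rs x∈ in y , there y∈ , r

  pointwise⇒covered⁻¹ : ∀ {xs ys} → Pointwise R xs ys → Covered (flip R) ys xs
  pointwise⇒covered⁻¹ (r ∷ _) (here refl) = _ , here refl , r
  pointwise⇒covered⁻¹ (_ ∷ rs) (there y∈) =
    let x , x∈ , r = pointwise⇒covered⁻¹ rs y∈ in x , there x∈ , r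

-- The order

noneAbove⁻ : ∀ {H xs} → NoneAbove H xs → All (λ x → ¬ H ≤g x) xs
noneAbove⁻ {xs = []} _ = []
noneAbove⁻ {xs = _ ∷ _} (p , ps) = p ∷ noneAbove⁻ ps

noneAbove⁺ : ∀ {H xs} → All (λ x → ¬ H ≤g x) xs → NoneAbove H xs
noneAbove⁺ [] = tt
noneAbove⁺ (p ∷ ps) = p , noneAbove⁺ ps

noneBelow⁻ : ∀ {G ys} → NoneBelow G ys → All (λ y → ¬ y ≤g G) ys
noneBelow⁻ {ys = []} _ = []
noneBelow⁻ {ys = _ ∷ _} (p , ps) = p ∷ noneBelow⁻ ps

noneBelow⁺ : ∀ {G ys} → All (λ y → ¬ y ≤g G) ys → NoneBelow G ys
noneBelow⁺ [] = tt
noneBelow⁺ (p ∷ ps) = p , noneBelow⁺ ps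

≤-leftOption : ∀ {G H x} → G ≤g H → x ∈ leftOpts G → ¬ H ≤g x
≤-leftOption {⟨ _ ∣ _ ⟩} {⟨ _ ∣ _ ⟩} (a , _) = All.lookup (noneAbove⁻ a)

≤-rightOption : ∀ {G H y} → G ≤g H → y ∈ rightOpts H → ¬ y ≤g G
≤-rightOption {⟨ _ ∣ _ ⟩} {⟨ _ ∣ _ ⟩} (_ , b) = All.lookup (noneBelow⁻ b)

≤-intro : ∀ {G H} → (∀ {x} → x ∈ leftOpts G → ¬ H ≤g x) →
          (∀ {y} → y ∈ rightOpts H → ¬ y ≤g G) → G ≤g H
≤-intro {⟨ _ ∣ _ ⟩} {⟨ _ ∣ _ ⟩} f g = noneAbove⁺ (All.tabulate f) , noneBelow⁺ (All.tabulate g)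

-- Recursing on a sublist xs ⊆ leftOpts G, rather than on membership proofs,
-- keeps these mutual recursions structural.
mutual
  ≤-refl : ∀ G → G ≤g G
  ≤-refl G@(⟨ L ∣ R ⟩) = noneAbove⁺ (≤-refl-left G L id) , noneBelow⁺ (≤-refl-right G R id)

  ≤-refl-left : ∀ G xs → xs ⊆ leftOpts G → All (λ x → ¬ G ≤g x) xs
  ≤-refl-left G [] _ = []
  ≤-refl-left G (x ∷ xs) ⊆L =
    (λ G≤x → ≤-leftOption G≤x (⊆L (here refl)) (≤-refl x)) ∷ ≤-refl-left G xs (⊆L ∘ there)

  ≤-refl-right : ∀ G ys → ys ⊆ rightOpts G → All (λ y → ¬ y ≤g G) ys
  ≤-refl-right G [] _ = []
  ≤-refl-right G (y ∷ ys) ⊆R =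
    (λ y≤G → ≤-rightOption y≤G (⊆R (here refl)) (≤-refl y)) ∷ ≤-refl-right G ys (⊆R ∘ there)

≈-refl : ∀ G → G ≈g G
≈-refl G = ≤-refl G , ≤-refl G

leftOption-≱ : ∀ {G x} → x ∈ leftOpts G → ¬ G ≤g x
leftOption-≱ {x = x} x∈ G≤x = ≤-leftOption G≤x x∈ (≤-refl x)

rightOption-≰ : ∀ {G y} → y ∈ rightOpts G → ¬ y ≤g G
rightOption-≰ {y = y} y∈ y≤G = ≤-rightOption y≤G y∈ (≤-refl y)

mutual
  ≤-trans : ∀ {G H K} → G ≤g H → H ≤g K → G ≤g K
  ≤-trans {⟨ GL ∣ _ ⟩} {H@(⟨ _ ∣ _ ⟩)} {⟨ _ ∣ KR ⟩} G≤H@(a , _) H≤K@(_ , b) =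
    noneAbove⁺ (≤-trans-left H GL (noneAbove⁻ a) H≤K) ,
    noneBelow⁺ (≤-trans-right H KR (noneBelow⁻ b) G≤H)

  ≤-trans-left : ∀ {K} H xs → All (λ x → ¬ H ≤g x) xs → H ≤g K → All (λ x → ¬ K ≤g x) xs
  ≤-trans-left H [] _ _ = []
  ≤-trans-left H (x ∷ xs) (H≰x ∷ ps) H≤K =
    (λ K≤x → H≰x (≤-trans H≤K K≤x)) ∷ ≤-trans-left H xs ps H≤K

  ≤-trans-right : ∀ {G} H ys → All (λ y → ¬ y ≤g H) ys → G ≤g H → All (λ y → ¬ y ≤g G) ys
  ≤-trans-right H [] _ _ = []
  ≤-trans-right H (y ∷ ys) (y≰H ∷ ps) G≤H =
    (λ y≤G → y≰H (≤-trans y≤G G≤H)) ∷ ≤-trans-right H ys ps G≤H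

mutual
  _≤?_ : ∀ G H → Dec (G ≤g H)
  ⟨ GL ∣ GR ⟩ ≤? ⟨ HL ∣ HR ⟩ = noneAbove? ⟨ HL ∣ HR ⟩ GL ×-dec noneBelow? ⟨ GL ∣ GR ⟩ HR

  noneAbove? : ∀ H xs → Dec (NoneAbove H xs)
  noneAbove? H [] = yes tt
  noneAbove? H (x ∷ xs) = ¬? (H ≤? x) ×-dec noneAbove? H xs

  noneBelow? : ∀ G ys → Dec (NoneBelow G ys)
  noneBelow? G [] = yes tt
  noneBelow? G (y ∷ ys) = ¬? (y ≤? G) ×-dec noneBelow? G ys

_<?_ : ∀ G H → Dec (G <g H)
G <? H = (G ≤? H) ×-dec ¬? (H ≤? G)

≰-witness : ∀ G H → ¬ G ≤g H →
  (Σ Game λ x → x ∈ leftOpts G × H ≤g x) ⊎ (Σ Game λ y → y ∈ rightOpts H × y ≤g G)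
≰-witness G@(⟨ GL ∣ _ ⟩) H@(⟨ _ ∣ HR ⟩) G≰H with noneAbove? H GL
... | no ¬above =
  let x , x∈ , ¬H≰x = ¬All⇒∃¬ (λ x → ¬? (H ≤? x)) (¬above ∘ noneAbove⁺)
  in inj₁ (x , x∈ , decidable-stable (H ≤? x) ¬H≰x)
... | yes above =
  let y , y∈ , ¬y≰G = ¬All⇒∃¬ (λ y → ¬? (y ≤? G)) (λ below → G≰H (above , noneBelow⁺ below))
  in inj₂ (y , y∈ , decidable-stable (y ≤? G) ¬y≰G)

dominated⇒≤ : ∀ {G H} → Covered _≤g_ (leftOpts G) (leftOpts H) →
              Covered (flip _≤g_) (rightOpts H) (rightOpts G) → G ≤g H
dominated⇒≤ {G} {H} domL domR = ≤-intro dominatedLeft dominatedRight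
  where
  dominatedLeft : ∀ {x} → x ∈ leftOpts G → ¬ H ≤g x
  dominatedLeft x∈ H≤x = let x' , x'∈ , x≤x' = domL x∈ in leftOption-≱ x'∈ (≤-trans H≤x x≤x')

  dominatedRight : ∀ {y} → y ∈ rightOpts H → ¬ y ≤g G
  dominatedRight y∈ y≤G = let y' , y'∈ , y'≤y = domR y∈ in rightOption-≰ y'∈ (≤-trans y'≤y y≤G)

pointwise-≈⇒≈ : ∀ {L L' R R'} → Pointwise _≈g_ L L' → Pointwise _≈g_ R R' →
                ⟨ L ∣ R ⟩ ≈g ⟨ L' ∣ R' ⟩
pointwise-≈⇒≈ L≈L' R≈R' =
  dominated⇒≤ (Covered-map proj₁ (pointwise⇒covered L≈L'))
              (Covered-map proj₁ (pointwise⇒covered⁻¹ R≈R')) ,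
  dominated⇒≤ (Covered-map proj₂ (pointwise⇒covered⁻¹ L≈L'))
              (Covered-map proj₂ (pointwise⇒covered R≈R'))

-- Sums

∈-addR : ∀ {x xs} H → x ∈ xs → (x +g H) ∈ addR xs H
∈-addR H (here refl) = here refl
∈-addR H (there x∈) = there (∈-addR H x∈)

∈-addL : ∀ {y ys} G → y ∈ ys → (G +g y) ∈ addL G ys
∈-addL G (here refl) = here refl
∈-addL G (there y∈) = there (∈-addL G y∈)

+-leftOptionˡ : ∀ {x} G H → x ∈ leftOpts G → (x +g H) ∈ leftOpts (G +g H)
+-leftOptionˡ ⟨ _ ∣ _ ⟩ ⟨ _ ∣ _ ⟩ x∈ = ∈-++⁺ˡ (∈-addR _ x∈)

+-leftOptionʳ : ∀ {y} G H → y ∈ leftOpts H → (G +g y) ∈ leftOpts (G +g H)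
+-leftOptionʳ ⟨ GL ∣ _ ⟩ ⟨ _ ∣ _ ⟩ y∈ = ∈-++⁺ʳ (addR GL _) (∈-addL _ y∈)

+-rightOptionˡ : ∀ {x} G H → x ∈ rightOpts G → (x +g H) ∈ rightOpts (G +g H)
+-rightOptionˡ ⟨ _ ∣ _ ⟩ ⟨ _ ∣ _ ⟩ x∈ = ∈-++⁺ˡ (∈-addR _ x∈)

+-rightOptionʳ : ∀ {y} G H → y ∈ rightOpts H → (G +g y) ∈ rightOpts (G +g H)
+-rightOptionʳ ⟨ _ ∣ GR ⟩ ⟨ _ ∣ _ ⟩ y∈ = ∈-++⁺ʳ (addR GR _) (∈-addL _ y∈)

mutual
  +-monoˡ-≤ : ∀ {G H} K → G ≤g H → (G +g K) ≤g (H +g K)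
  +-monoˡ-≤ {G@(⟨ GL ∣ _ ⟩)} {H@(⟨ _ ∣ HR ⟩)} K@(⟨ KL ∣ KR ⟩) G≤H@(a , b) =
    noneAbove⁺ (++⁺ (+-monoˡ-leftAddR K GL (noneAbove⁻ a)) (+-monoˡ-leftAddL K KL id G≤H)) ,
    noneBelow⁺ (++⁺ (+-monoˡ-rightAddR K HR (noneBelow⁻ b)) (+-monoˡ-rightAddL K KR id G≤H))

  +-monoˡ-leftAddR : ∀ {H} K xs → All (λ x → ¬ H ≤g x) xs → All (λ z → ¬ (H +g K) ≤g z) (addR xs K)
  +-monoˡ-leftAddR K [] _ = []
  +-monoˡ-leftAddR K (x ∷ xs) (H≰x ∷ ps) = (H≰x ∘ +-cancelʳ-≤ K) ∷ +-monoˡ-leftAddR K xs ps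

  +-monoˡ-rightAddR : ∀ {G} K ys → All (λ y → ¬ y ≤g G) ys → All (λ z → ¬ z ≤g (G +g K)) (addR ys K)
  +-monoˡ-rightAddR K [] _ = []
  +-monoˡ-rightAddR K (y ∷ ys) (y≰G ∷ ps) = (y≰G ∘ +-cancelʳ-≤ K) ∷ +-monoˡ-rightAddR K ys ps

  +-monoˡ-leftAddL : ∀ {G H} K ys → ys ⊆ leftOpts K → G ≤g H →
                 All (λ z → ¬ (H +g K) ≤g z) (addL G ys)
  +-monoˡ-leftAddL K [] _ _ = []
  +-monoˡ-leftAddL {G} {H} K (y ∷ ys) ⊆L G≤H =
    (λ H+K≤G+y → leftOption-≱ (+-leftOptionʳ H K (⊆L (here refl)))
                              (≤-trans H+K≤G+y (+-monoˡ-≤ y G≤H)))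
    ∷ +-monoˡ-leftAddL K ys (⊆L ∘ there) G≤H

  +-monoˡ-rightAddL : ∀ {G H} K ys → ys ⊆ rightOpts K → G ≤g H →
                  All (λ z → ¬ z ≤g (G +g K)) (addL H ys)
  +-monoˡ-rightAddL K [] _ _ = []
  +-monoˡ-rightAddL {G} {H} K (y ∷ ys) ⊆R G≤H =
    (λ H+y≤G+K → rightOption-≰ (+-rightOptionʳ G K (⊆R (here refl)))
                               (≤-trans (+-monoˡ-≤ y G≤H) H+y≤G+K))
    ∷ +-monoˡ-rightAddL K ys (⊆R ∘ there) G≤H

  +-cancelʳ-≤ : ∀ {G H} K → (G +g K) ≤g (H +g K) → G ≤g H
  +-cancelʳ-≤ {G@(⟨ GL ∣ _ ⟩)} {H@(⟨ _ ∣ HR ⟩)} K@(⟨ _ ∣ _ ⟩) G+K≤H+K =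
    noneAbove⁺ (+-cancelʳ-left K GL id G+K≤H+K) , noneBelow⁺ (+-cancelʳ-right K HR id G+K≤H+K)

  +-cancelʳ-left : ∀ {G H} K xs → xs ⊆ leftOpts G → (G +g K) ≤g (H +g K) → All (λ x → ¬ H ≤g x) xs
  +-cancelʳ-left K [] _ _ = []
  +-cancelʳ-left {G} K (x ∷ xs) ⊆L G+K≤H+K =
    (λ H≤x → leftOption-≱ (+-leftOptionˡ G K (⊆L (here refl))) (≤-trans G+K≤H+K (+-monoˡ-≤ K H≤x)))
    ∷ +-cancelʳ-left K xs (⊆L ∘ there) G+K≤H+K

  +-cancelʳ-right : ∀ {G H} K ys → ys ⊆ rightOpts H → (G +g K) ≤g (H +g K) → All (λ y → ¬ y ≤g G) ys
  +-cancelʳ-right K [] _ _ = []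
  +-cancelʳ-right {H = H} K (y ∷ ys) ⊆R G+K≤H+K =
    (λ y≤G → rightOption-≰ (+-rightOptionˡ H K (⊆R (here refl))) (≤-trans (+-monoˡ-≤ K y≤G) G+K≤H+K))
    ∷ +-cancelʳ-right K ys (⊆R ∘ there) G+K≤H+K

-- Negation

mutual
  neg : Game → Game
  neg ⟨ L ∣ R ⟩ = ⟨ negs R ∣ negs L ⟩

  negs : List Game → List Game
  negs [] = []
  negs (x ∷ xs) = neg x ∷ negs xs

mutual
  neg-involutive : ∀ G → neg (neg G) ≡ G
  neg-involutive ⟨ L ∣ R ⟩ = cong₂ ⟨_∣_⟩ (negs-involutive L) (negs-involutive R)

  negs-involutive : ∀ xs → negs (negs xs) ≡ xs
  negs-involutive [] = refl
  negs-involutive (x ∷ xs) = cong₂ _∷_ (neg-involutive x) (negs-involutive xs)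

∈-negs⁺ : ∀ {x xs} → x ∈ xs → neg x ∈ negs xs
∈-negs⁺ (here refl) = here refl
∈-negs⁺ (there x∈) = there (∈-negs⁺ x∈)

∈-negs⁻ : ∀ {y} xs → y ∈ negs xs → Σ Game λ x → x ∈ xs × y ≡ neg x
∈-negs⁻ (x ∷ _) (here refl) = x , here refl , refl
∈-negs⁻ (_ ∷ xs) (there y∈) = let x , x∈ , y≡ = ∈-negs⁻ xs y∈ in x , there x∈ , y≡

neg-leftOption : ∀ {x} G → x ∈ leftOpts G → neg x ∈ rightOpts (neg G)
neg-leftOption ⟨ _ ∣ _ ⟩ = ∈-negs⁺

neg-rightOption : ∀ {x} G → x ∈ rightOpts G → neg x ∈ leftOpts (neg G)
neg-rightOption ⟨ _ ∣ _ ⟩ = ∈-negs⁺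

mutual
  neg-antimono-≤ : ∀ {G H} → G ≤g H → neg H ≤g neg G
  neg-antimono-≤ {⟨ GL ∣ _ ⟩} {⟨ _ ∣ HR ⟩} (a , b) =
    noneAbove⁺ (neg-antimono-right HR (noneBelow⁻ b)) , noneBelow⁺ (neg-antimono-left GL (noneAbove⁻ a))

  neg-antimono-left : ∀ {H} xs → All (λ x → ¬ H ≤g x) xs → All (λ z → ¬ z ≤g neg H) (negs xs)
  neg-antimono-left [] _ = []
  neg-antimono-left (x ∷ xs) (H≰x ∷ ps) = (H≰x ∘ neg-cancel-≤) ∷ neg-antimono-left xs ps

  neg-antimono-right : ∀ {G} ys → All (λ y → ¬ y ≤g G) ys → All (λ z → ¬ neg G ≤g z) (negs ys)
  neg-antimono-right [] _ = []
  neg-antimono-right (y ∷ ys) (y≰G ∷ ps) = (y≰G ∘ neg-cancel-≤) ∷ neg-antimono-right ys ps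

  neg-cancel-≤ : ∀ {G H} → neg H ≤g neg G → G ≤g H
  neg-cancel-≤ {⟨ GL ∣ _ ⟩} {⟨ _ ∣ HR ⟩} (c , d) =
    noneAbove⁺ (neg-cancel-left GL (noneBelow⁻ d)) , noneBelow⁺ (neg-cancel-right HR (noneAbove⁻ c))

  neg-cancel-left : ∀ {H} xs → All (λ z → ¬ z ≤g neg H) (negs xs) → All (λ x → ¬ H ≤g x) xs
  neg-cancel-left [] _ = []
  neg-cancel-left (x ∷ xs) (p ∷ ps) = (p ∘ neg-antimono-≤) ∷ neg-cancel-left xs ps

  neg-cancel-right : ∀ {G} ys → All (λ z → ¬ neg G ≤g z) (negs ys) → All (λ y → ¬ y ≤g G) ys
  neg-cancel-right [] _ = []
  neg-cancel-right (y ∷ ys) (p ∷ ps) = (p ∘ neg-antimono-≤) ∷ neg-cancel-right ys ps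

mutual
  +-inverseʳ-≤0 : ∀ G → (G +g neg G) ≤g 0g
  +-inverseʳ-≤0 G@(⟨ L ∣ R ⟩) =
    noneAbove⁺ (++⁺ (+-inverseʳ-≤0-addR G L id) (+-inverseʳ-≤0-addL G R id)) , tt

  +-inverseʳ-≤0-addR : ∀ G xs → xs ⊆ leftOpts G → All (λ z → ¬ 0g ≤g z) (addR xs (neg G))
  +-inverseʳ-≤0-addR G [] _ = []
  +-inverseʳ-≤0-addR G (x ∷ xs) ⊆L =
    (λ 0≤ → ≤-rightOption 0≤ (+-rightOptionʳ x (neg G) (neg-leftOption G (⊆L (here refl))))
                             (+-inverseʳ-≤0 x))
    ∷ +-inverseʳ-≤0-addR G xs (⊆L ∘ there)

  +-inverseʳ-≤0-addL : ∀ G ys → ys ⊆ rightOpts G → All (λ z → ¬ 0g ≤g z) (addL G (negs ys))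
  +-inverseʳ-≤0-addL G [] _ = []
  +-inverseʳ-≤0-addL G (y ∷ ys) ⊆R =
    (λ 0≤ → ≤-rightOption 0≤ (+-rightOptionˡ G (neg y) (⊆R (here refl))) (+-inverseʳ-≤0 y))
    ∷ +-inverseʳ-≤0-addL G ys (⊆R ∘ there)

mutual
  +-inverseʳ-≥0 : ∀ G → 0g ≤g (G +g neg G)
  +-inverseʳ-≥0 G@(⟨ L ∣ R ⟩) =
    tt , noneBelow⁺ (++⁺ (+-inverseʳ-≥0-addR G R id) (+-inverseʳ-≥0-addL G L id))

  +-inverseʳ-≥0-addR : ∀ G ys → ys ⊆ rightOpts G → All (λ z → ¬ z ≤g 0g) (addR ys (neg G))
  +-inverseʳ-≥0-addR G [] _ = []
  +-inverseʳ-≥0-addR G (y ∷ ys) ⊆R =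
    (λ ≤0 → ≤-leftOption ≤0 (+-leftOptionʳ y (neg G) (neg-rightOption G (⊆R (here refl))))
                            (+-inverseʳ-≥0 y))
    ∷ +-inverseʳ-≥0-addR G ys (⊆R ∘ there)

  +-inverseʳ-≥0-addL : ∀ G xs → xs ⊆ leftOpts G → All (λ z → ¬ z ≤g 0g) (addL G (negs xs))
  +-inverseʳ-≥0-addL G [] _ = []
  +-inverseʳ-≥0-addL G (x ∷ xs) ⊆L =
    (λ ≤0 → ≤-leftOption ≤0 (+-leftOptionˡ G (neg x) (⊆L (here refl))) (+-inverseʳ-≥0 x))
    ∷ +-inverseʳ-≥0-addL G xs (⊆L ∘ there)

+-inverseˡ : ∀ G → (neg G +g G) ≈g 0g
+-inverseˡ G = subst (λ H → (neg G +g H) ≈g 0g) (neg-involutive G)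
                     (+-inverseʳ-≤0 (neg G) , +-inverseʳ-≥0 (neg G))

≤-neg⇒+≤0 : ∀ {G x} → G ≤g neg x → (G +g x) ≤g 0g
≤-neg⇒+≤0 {x = x} G≤-x = ≤-trans (+-monoˡ-≤ x G≤-x) (proj₁ (+-inverseˡ x))

neg≤⇒0≤+ : ∀ {G x} → neg x ≤g G → 0g ≤g (G +g x)
neg≤⇒0≤+ {x = x} -x≤G = ≤-trans (proj₂ (+-inverseˡ x)) (+-monoˡ-≤ x -x≤G)

-- Outcomes

mutual
  leftWinsFirst⇒≰0 : ∀ G → LeftWinsFirst G → ¬ G ≤g 0g
  leftWinsFirst⇒≰0 ⟨ L ∣ _ ⟩ w (a , _) = someRightLoses⇒¬noneAbove0 L w a

  someRightLoses⇒¬noneAbove0 : ∀ xs → SomeRightLoses xs → ¬ NoneAbove 0g xs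
  someRightLoses⇒¬noneAbove0 (x ∷ _) (inj₁ ¬rwf) (0≰x , _) = ¬rwf (0≰⇒rightWinsFirst x 0≰x)
  someRightLoses⇒¬noneAbove0 (_ ∷ xs) (inj₂ w) (_ , ps) = someRightLoses⇒¬noneAbove0 xs w ps

  rightWinsFirst⇒0≰ : ∀ G → RightWinsFirst G → ¬ 0g ≤g G
  rightWinsFirst⇒0≰ ⟨ _ ∣ R ⟩ w (_ , b) = someLeftLoses⇒¬noneBelow0 R w b

  someLeftLoses⇒¬noneBelow0 : ∀ ys → SomeLeftLoses ys → ¬ NoneBelow 0g ys
  someLeftLoses⇒¬noneBelow0 (y ∷ _) (inj₁ ¬lwf) (y≰0 , _) = ¬lwf (≰0⇒leftWinsFirst y y≰0)
  someLeftLoses⇒¬noneBelow0 (_ ∷ ys) (inj₂ w) (_ , ps) = someLeftLoses⇒¬noneBelow0 ys w ps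

  ≰0⇒leftWinsFirst : ∀ G → ¬ G ≤g 0g → LeftWinsFirst G
  ≰0⇒leftWinsFirst ⟨ L ∣ _ ⟩ G≰0 = ¬noneAbove0⇒someRightLoses L (λ a → G≰0 (a , tt))

  ¬noneAbove0⇒someRightLoses : ∀ xs → ¬ NoneAbove 0g xs → SomeRightLoses xs
  ¬noneAbove0⇒someRightLoses [] ¬a = ¬a tt
  ¬noneAbove0⇒someRightLoses (x ∷ xs) ¬a with 0g ≤? x
  ... | yes 0≤x = inj₁ (λ rwf → rightWinsFirst⇒0≰ x rwf 0≤x)
  ... | no 0≰x = inj₂ (¬noneAbove0⇒someRightLoses xs (λ a → ¬a (0≰x , a)))

  0≰⇒rightWinsFirst : ∀ G → ¬ 0g ≤g G → RightWinsFirst G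
  0≰⇒rightWinsFirst ⟨ _ ∣ R ⟩ 0≰G = ¬noneBelow0⇒someLeftLoses R (λ b → 0≰G (tt , b))

  ¬noneBelow0⇒someLeftLoses : ∀ ys → ¬ NoneBelow 0g ys → SomeLeftLoses ys
  ¬noneBelow0⇒someLeftLoses [] ¬b = ¬b tt
  ¬noneBelow0⇒someLeftLoses (y ∷ ys) ¬b with y ≤? 0g
  ... | yes y≤0 = inj₁ (λ lwf → leftWinsFirst⇒≰0 y lwf y≤0)
  ... | no y≰0 = inj₂ (¬noneBelow0⇒someLeftLoses ys (λ b → ¬b (y≰0 , b)))

InN⇒¬comparable-0 : ∀ {G} → InN G → ¬ Comparable G 0g
InN⇒¬comparable-0 {G} (lwf , _) (inj₁ G≤0) = leftWinsFirst⇒≰0 G lwf G≤0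
InN⇒¬comparable-0 {G} (_ , rwf) (inj₂ 0≤G) = rightWinsFirst⇒0≰ G rwf 0≤G

fuzzy⇒InN : ∀ {G} → ¬ G ≤g 0g → ¬ 0g ≤g G → InN G
fuzzy⇒InN {G} G≰0 0≰G = ≰0⇒leftWinsFirst G G≰0 , 0≰⇒rightWinsFirst G 0≰G

-- Numbers

allNumeric-∈ : ∀ {x xs} → AllNumeric xs → x ∈ xs → IsNumericForm x
allNumeric-∈ (nx , _) (here refl) = nx
allNumeric-∈ (_ , nxs) (there x∈) = allNumeric-∈ nxs x∈

numericForm⇒number : ∀ {a} → IsNumericForm a → IsNumber a
numericForm⇒number {a} na = a , na , ≈-refl a

leftOption<rightOption : ∀ {a x y} → IsNumericForm a → x ∈ leftOpts a → y ∈ rightOpts a → x <g y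
leftOption<rightOption {⟨ _ ∣ _ ⟩} (_ , _ , L<R) x∈ y∈ = All.lookup (All.lookup L<R x∈) y∈

mutual
  numeric-leftOption≤ : ∀ {a x} → IsNumericForm a → x ∈ leftOpts a → x ≤g a
  numeric-leftOption≤ {⟨ L ∣ _ ⟩} na@(nL , _) = All.lookup (numeric-leftOptions≤ L nL id na)

  numeric-leftOptions≤ : ∀ {a} xs → AllNumeric xs → xs ⊆ leftOpts a → IsNumericForm a → All (_≤g a) xs
  numeric-leftOptions≤ [] _ _ _ = []
  numeric-leftOptions≤ (x ∷ xs) (nx , nxs) ⊆L na =
    ≤-intro (λ xl∈ a≤xl → leftOption-≱ (⊆L (here refl)) (≤-trans a≤xl (numeric-leftOption≤ nx xl∈)))
            (λ r∈ r≤x → proj₂ (leftOption<rightOption na (⊆L (here refl)) r∈) r≤x)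
    ∷ numeric-leftOptions≤ xs nxs (⊆L ∘ there) na

mutual
  numeric≤rightOption : ∀ {a y} → IsNumericForm a → y ∈ rightOpts a → a ≤g y
  numeric≤rightOption {⟨ _ ∣ R ⟩} na@(_ , nR , _) = All.lookup (numeric≤rightOptions R nR id na)

  numeric≤rightOptions : ∀ {a} ys → AllNumeric ys → ys ⊆ rightOpts a → IsNumericForm a → All (a ≤g_) ys
  numeric≤rightOptions [] _ _ _ = []
  numeric≤rightOptions (y ∷ ys) (ny , nys) ⊆R na =
    ≤-intro (λ l∈ y≤l → proj₂ (leftOption<rightOption na l∈ (⊆R (here refl))) y≤l)
            (λ yr∈ yr≤a → rightOption-≰ (⊆R (here refl)) (≤-trans (numeric≤rightOption ny yr∈) yr≤a))
    ∷ numeric≤rightOptions ys nys (⊆R ∘ there) na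

numeric-total : ∀ {a b} → IsNumericForm a → IsNumericForm b → Comparable a b
numeric-total {a} {b} na nb with a ≤? b
... | yes a≤b = inj₁ a≤b
... | no a≰b with ≰-witness a b a≰b
... | inj₁ (x , x∈ , b≤x) = inj₂ (≤-trans b≤x (numeric-leftOption≤ na x∈))
... | inj₂ (y , y∈ , y≤a) = inj₂ (≤-trans (numeric≤rightOption nb y∈) y≤a)

numeric-≮⇒≥ : ∀ {a b} → IsNumericForm a → IsNumericForm b → ¬ a <g b → b ≤g a
numeric-≮⇒≥ {a} {b} na nb a≮b with numeric-total na nb
... | inj₁ a≤b = decidable-stable (b ≤? a) (λ b≰a → a≮b (a≤b , b≰a))
... | inj₂ b≤a = b≤a

neg-antimono-< : ∀ {x y} → x <g y → neg y <g neg x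
neg-antimono-< (x≤y , y≰x) = neg-antimono-≤ x≤y , y≰x ∘ neg-cancel-≤

mutual
  neg-numeric : ∀ {a} → IsNumericForm a → IsNumericForm (neg a)
  neg-numeric {⟨ L ∣ R ⟩} (nL , nR , L<R) =
    negs-numeric R nR , negs-numeric L nL , All.tabulate λ l∈ → All.tabulate λ r∈ → negs<negs l∈ r∈
    where
    negs<negs : ∀ {l' r'} → l' ∈ negs R → r' ∈ negs L → l' <g r'
    negs<negs {l'} {r'} l'∈ r'∈ with ∈-negs⁻ R l'∈ | ∈-negs⁻ L r'∈
    ... | r , r∈ , refl | l , l∈ , refl = neg-antimono-< (All.lookup (All.lookup L<R l∈) r∈)

  negs-numeric : ∀ xs → AllNumeric xs → AllNumeric (negs xs)
  negs-numeric [] _ = tt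
  negs-numeric (x ∷ xs) (nx , nxs) = neg-numeric nx , negs-numeric xs nxs

number-+-comparable-0 : ∀ {G x} → IsNumber G → IsNumber x → Comparable (G +g x) 0g
number-+-comparable-0 (y , ny , G≤y , y≤G) (z , nz , x≤z , z≤x) with numeric-total ny (neg-numeric nz)
... | inj₁ y≤-z = inj₁ (≤-neg⇒+≤0 (≤-trans G≤y (≤-trans y≤-z (neg-antimono-≤ x≤z))))
... | inj₂ -z≤y = inj₂ (neg≤⇒0≤+ (≤-trans (neg-antimono-≤ z≤x) (≤-trans -z≤y y≤G)))

-- Positions whose options are numbers

straddled⇒InN : ∀ {G z l r} → l ∈ leftOpts G → r ∈ rightOpts G → z ≤g l → r ≤g z →
                InN (G +g neg z)
straddled⇒InN {G} {z} l∈ r∈ z≤l r≤z = fuzzy⇒InN {G +g neg z}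
  (λ G-z≤0 → ≤-leftOption G-z≤0 (+-leftOptionˡ G (neg z) l∈)
               (≤-trans (+-inverseʳ-≥0 z) (+-monoˡ-≤ (neg z) z≤l)))
  (λ 0≤G-z → ≤-rightOption 0≤G-z (+-rightOptionˡ G (neg z) r∈)
               (≤-trans (+-monoˡ-≤ (neg z) r≤z) (+-inverseʳ-≤0 z)))

numericRepresentatives : ∀ {xs} → All IsNumber xs →
  Σ (List Game) λ ys → AllNumeric ys × Pointwise _≈g_ xs ys
numericRepresentatives [] = [] , tt , []
numericRepresentatives ((y , ny , x≈y) ∷ ps) =
  let ys , nys , xs≈ys = numericRepresentatives ps in y ∷ ys , (ny , nys) , x≈y ∷ xs≈ys

numberOptions⇒number⊎shiftInN : ∀ {L R} → All IsNumber L → All IsNumber R →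
  IsNumber ⟨ L ∣ R ⟩ ⊎ Σ Game (λ x → IsNumber x × InN (⟨ L ∣ R ⟩ +g x))
numberOptions⇒number⊎shiftInN {L} {R} pL pR with numericRepresentatives pL | numericRepresentatives pR
... | L' , nL' , L≈L' | R' , nR' , R≈R' with all? (λ l → all? (l <?_) R') L'
... | yes L'<R' = inj₁ (⟨ L' ∣ R' ⟩ , (nL' , nR' , L'<R') , pointwise-≈⇒≈ L≈L' R≈R')
... | no ¬L'<R' =
  let l' , l'∈ , ¬l'<R' = ¬All⇒∃¬ (λ l → all? (l <?_) R') ¬L'<R'
      r' , r'∈ , l'≮r' = ¬All⇒∃¬ (l' <?_) ¬l'<R'
      l , l∈ , l≈l' = pointwise⇒covered⁻¹ L≈L' l'∈
      r , r∈ , r≈r' = pointwise⇒covered⁻¹ R≈R' r'∈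
      nl' = allNumeric-∈ nL' l'∈
      r'≤l' = numeric-≮⇒≥ nl' (allNumeric-∈ nR' r'∈) l'≮r'
  in inj₂ (neg l' , numericForm⇒number (neg-numeric nl') ,
           straddled⇒InN {⟨ L ∣ R ⟩} l∈ r∈ (proj₂ l≈l') (≤-trans (proj₁ r≈r') r'≤l'))

allNumbers⇒noNShift : (S : Game → Set) → ((G : Game) → S G → IsNumber G) →
  ¬ (Σ Game (λ G → Σ Game (λ x → S G × IsNumber x × InN (G +g x))))
allNumbers⇒noNShift S numbers (G , x , G∈S , x-number , inN) =
  InN⇒¬comparable-0 inN (number-+-comparable-0 (numbers G G∈S) x-number)

module _ (S : Game → Set) (closed : IsHCR S)
         (noNShift : ¬ (Σ Game (λ G → Σ Game (λ x → S G × IsNumber x × InN (G +g x))))) where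

  mutual
    noNShift⇒number : (G : Game) → S G → IsNumber G
    noNShift⇒number G@(⟨ L ∣ R ⟩) G∈S =
      fromInj₁ (λ (x , x-number , inN) → ⊥-elim (noNShift (G , x , G∈S , x-number , inN)))
               (numberOptions⇒number⊎shiftInN (noNShift⇒numbers L (proj₁ (closed G G∈S)))
                                              (noNShift⇒numbers R (proj₂ (closed G G∈S))))

    noNShift⇒numbers : ∀ xs → All S xs → All IsNumber xs
    noNShift⇒numbers [] [] = []
    noNShift⇒numbers (x ∷ xs) (x∈S ∷ xs∈S) = noNShift⇒number x x∈S ∷ noNShift⇒numbers xs xs∈S

mainTheorem1 : (S : Game → Set) → IsHCR S →
    (((G : Game) → S G → IsNumber G) →
       ¬ (Σ Game (λ G → Σ Game (λ x → S G × IsNumber x × InN (G +g x)))))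
    × ((¬ (Σ Game (λ G → Σ Game (λ x → S G × IsNumber x × InN (G +g x))))) →
       (G : Game) → S G → IsNumber G)
mainTheorem1 S closed = allNumbers⇒noNShift S , noNShift⇒number S closed
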